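{- Let $r\ge1$ and $u,v\in X_0^+(2r)$. Let $d=\min\{u_r-u_{r+1},v_r-v_{r+1}\}$, $\ell=(0,\dots,0,1,\dots,1)\in\mathbb{Z}^{2r}$ ($r$ zeros followed by $r$ ones), $\hat u=u+d\ell$, $\hat v=v+d\ell$. Then $u_{2\rho-1}\ge v_{2\rho-1}\ge v_{2\rho}\ge u_{2\rho}$ for all $\rho=1,\dots,r$ if and only if $d(\hat u)=0$ when $r$ is even (resp. $d(\hat v)=0$ when $r$ is odd) and $\theta_i'(\hat v)\prec\theta_i(\hat u)$ for $i=1,2$.
   Context: $X_0^+(2r)$ is the set of $x\in\mathbb{Z}^{2r}$ with $x_1\ge\dots\ge x_{2r}$ and $x_i+x_{2r+1-i}$ independent of $i$. The defect of $x\in X_0^+(2r)$ is $d(x)=x_r-x_{r+1}$. For $\alpha\in\mathbb{Z}^{r+1}$, $\beta\in\mathbb{Z}^r$, $\beta\prec\alpha$ means $\alpha_\rho\ge\beta_\rho\ge\alpha_{\rho+1}$ for $\rho=1,\dots,r$. Splitting maps on $x\in\mathbb{Z}^{2r}$: for $r$ even $\theta_1(x)=(x_1,x_2,x_4,\dots,x_r,x_{r+3},x_{r+5},\dots,x_{2r-1},x_{2r})$, $\theta_2(x)=(x_1,x_3,\dots,x_{r-1},x_{r+1},x_{r+2},x_{r+4},\dots,x_{2r})$, $\theta'_1(x)=(x_2,x_4,\dots,x_r,x_{r+1},x_{r+3},\dots,x_{2r-1})$, $\theta'_2(x)=(x_1,x_3,\dots,x_{r-1},x_{r+2},x_{r+4},\dots,x_{2r})$;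 for $r$ odd $\theta_1(x)=(x_1,x_2,x_4,\dots,x_{r-1},x_{r+2},x_{r+4},\dots,x_{2r-1},x_{2r})$, $\theta_2(x)=(x_1,x_3,\dots,x_r,x_{r+1},x_{r+3},\dots,x_{2r})$, $\theta'_1(x)=(x_2,x_4,\dots,x_{r+1},x_{r+2},x_{r+4},\dots,x_{2r-1})$, $\theta'_2(x)=(x_1,x_3,\dots,x_r,x_{r+3},x_{r+5},\dots,x_{2r})$. (In the paper $\theta_i$ for even $r$ and $\theta'_i$ for odd $r$ are defined only on weights with $x_r=x_{r+1}$.) -}

module Defs where

open import Data.Nat as ℕ using (ℕ; zero; suc; _∸_; _≤ᵇ_)
open import Data.Integer as ℤ using (ℤ; _⊓_; 0ℤ)
open import Data.Bool using (Bool; true; false; if_then_else_)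
open import Data.List using (List; []; _∷_; _++_; length)
open import Data.Vec using (Vec; toList; tabulate; lookup)
open import Data.Fin using (Fin; toℕ)
open import Data.Product using (_×_; ∃)
open import Relation.Binary.PropositionalEquality using (_≡_)

-- 1-based lookup in a list, default 0 outside the range (never used outside range)
nth : List ℤ → ℕ → ℤ
nth []       _             = 0ℤ
nth (a ∷ as) zero          = 0ℤ
nth (a ∷ as) (suc zero)    = a
nth (a ∷ as) (suc (suc i)) = nth as (suc i)

at : ∀ {n} → Vec ℤ n → ℕ → ℤ
at x i = nth (toList x) i

X0+ : (r : ℕ) → Vec ℤ (2 ℕ.* r) → Set
X0+ r x =
  (∀ i → 1 ℕ.≤ i → i ℕ.< 2 ℕ.* r → at x (suc i) ℤ.≤ at x i)
  × (∀ i j → 1 ℕ.≤ i → i ℕ.≤ 2 ℕ.* r → 1 ℕ.≤ j → j ℕ.≤ 2 ℕ.* r →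
       at x i ℤ.+ at x (suc (2 ℕ.* r) ∸ i) ≡ at x j ℤ.+ at x (suc (2 ℕ.* r) ∸ j))

defect : (r : ℕ) → Vec ℤ (2 ℕ.* r) → ℤ
defect r x = at x r ℤ.- at x (suc r)

addℓ : (r : ℕ) → ℤ → Vec ℤ (2 ℕ.* r) → Vec ℤ (2 ℕ.* r)
addℓ r d x = tabulate λ (i : Fin (2 ℕ.* r)) →
  lookup x i ℤ.+ (if r ≤ᵇ toℕ i then d else 0ℤ)

_≺_ : List ℤ → List ℤ → Set
β ≺ α = (length α ≡ suc (length β))
  × (∀ ρ → 1 ℕ.≤ ρ → ρ ℕ.≤ length β →
       (nth β ρ ℤ.≤ nth α ρ) × (nth α (suc ρ) ℤ.≤ nth β ρ))

even : ℕ → Bool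
even zero = true
even (suc zero) = false
even (suc (suc n)) = even n

half : ℕ → ℕ
half zero = zero
half (suc zero) = zero
half (suc (suc n)) = suc (half n)

step2 : ℕ → ℕ → List ℕ
step2 a zero    = []
step2 a (suc k) = a ∷ step2 (suc (suc a)) k

-- index lists (1-based) of the splitting maps; m = ⌊r/2⌋
θ₁ix θ₂ix θ₁'ix θ₂'ix : ℕ → List ℕ
θ₁ix r = if even r
  then (1 ∷ step2 2 (half r)) ++ (step2 (3 ℕ.+ r) (half r ∸ 1) ++ (2 ℕ.* r ∷ []))
  else (1 ∷ step2 2 (half r)) ++ (step2 (2 ℕ.+ r) (half r) ++ (2 ℕ.* r ∷ []))
θ₂ix r = if even r
  then step2 1 (half r) ++ (suc r ∷ step2 (2 ℕ.+ r) (half r))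
  else step2 1 (suc (half r)) ++ step2 (suc r) (suc (half r))
θ₁'ix r = if even r
  then step2 2 (half r) ++ step2 (suc r) (half r)
  else step2 2 (suc (half r)) ++ step2 (2 ℕ.+ r) (half r)
θ₂'ix r = if even r
  then step2 1 (half r) ++ step2 (2 ℕ.+ r) (half r)
  else step2 1 (suc (half r)) ++ step2 (3 ℕ.+ r) (half r)

select : ∀ {n} → Vec ℤ n → List ℕ → List ℤ
select x [] = []
select x (i ∷ is) = at x i ∷ select x is

θ₁ θ₂ θ₁' θ₂' : (r : ℕ) → Vec ℤ (2 ℕ.* r) → List ℤ
θ₁ r x = select x (θ₁ix r)
θ₂ r x = select x (θ₂ix r)
θ₁' r x = select x (θ₁'ix r)
θ₂' r x = select x (θ₂'ix r)

module Submission where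

-- Write X = û and Y = v̂ as functions of the index. The interlacing says Y ≤ X at odd and
-- X ≤ Y at even indices (its middle inequality holds since v decreases), and as û, v̂ are
-- u, v shifted by the same amount at every index, the same holds for X, Y (Interlaced).
-- A relation β ≺ α says exactly that the weave α₁, β₁, α₂, β₂, … descends; for θᵢ' ≺ θᵢ
-- this weave is a block of pairs Yₚ, Xₚ at even p, one entry at r + 1 and a block of pairs
-- Xₚ, Yₚ at odd p (chain₁, chain₂).  X and Y decrease because d is at most both defects.
-- * Interlaced ⇒ the chains descend: inside a pair this is the interlacing itself, between
--   different indices it follows from interlacing and monotonicity (module Zigzag); the
--   defect condition holds as interlacing at r, r + 1 decides which defect is smaller.
-- * The chains descend ⇒ Interlaced: the pairs of the two chains cover every index but
--   r + 1, where the vanishing defect (Xᵣ = Xᵣ₊₁ or Yᵣ = Yᵣ₊₁) and the link of a chain at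
--   r + 1 supply the missing inequality.

open import Defs
open import Data.Nat as ℕ using (ℕ; suc; _∸_)
open import Data.Integer as ℤ using (ℤ; _⊓_)
open import Data.Bool using (if_then_else_)
open import Data.Vec using (Vec)
open import Data.Product using (_×_)
open import Function.Bundles using (_⇔_)
open import Relation.Binary.PropositionalEquality using (_≡_)

open import Data.Nat using (zero; z≤n; s≤s; _+_; _≤_; _<_; _≤?_; _<?_)
import Data.Nat.Properties as ℕP
import Data.Nat.Tactic.RingSolver as ℕSolver
open import Data.Integer using (0ℤ)
import Data.Integer.Properties as ℤP
open import Data.Bool using (Bool; true; false)
open import Data.Bool.Properties using (T-≡; ¬-not)
open import Data.Vec using (_∷_; lookup)
open import Data.Vec.Properties using (lookup∘tabulate)
open import Data.Fin using (fromℕ<; toℕ)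
open import Data.Fin.Properties using (toℕ-fromℕ<)
import Data.Integer.Tactic.RingSolver as ℤSolver
open import Data.List using (List; []; _∷_; _++_; length)
import Data.List.Properties as ListP
open import Data.List.Relation.Unary.Linked using (Linked; []; [-]; _∷_)
open import Data.Product using (_,_; proj₁; proj₂; ∃)
open import Data.Sum using (_⊎_; inj₁; inj₂)
open import Data.Empty using (⊥-elim)
open import Function.Base using (_∘_)
open import Function.Bundles using (mk⇔; Equivalence)
open import Function.Construct.Composition using (_⇔-∘_)
open import Relation.Binary.PropositionalEquality
  using (refl; sym; trans; cong; cong₂; subst; subst₂; module ≡-Reasoning)
open import Relation.Nullary using (yes; no)
open import Relation.Binary.Definitions using (tri<; tri≈; tri>)

private
  variable
    a b c i j k l n : ℕ
    F G f g : ℕ → ℤ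

-- Arithmetic progressions a, a+2, a+4, …

-- prog a j = a + 2j, the j-th term of the list  step2 a k
prog : ℕ → ℕ → ℕ
prog a zero    = a
prog a (suc j) = prog (suc (suc a)) j

prog-closed : ∀ a j → prog a j ≡ j + j + a
prog-closed a zero    = refl
prog-closed a (suc j) = trans (prog-closed (suc (suc a)) j) (shift j a)
  where
  shift : ∀ j a → j + j + suc (suc a) ≡ suc j + suc j + a
  shift = ℕSolver.solve-∀

prog-+ : ∀ a i j → prog a (i + j) ≡ prog (prog a i) j
prog-+ a zero    j = refl
prog-+ a (suc i) j = prog-+ (suc (suc a)) i j

suc-prog : ∀ a j → suc (prog a j) ≡ prog (suc a) j
suc-prog a zero    = refl
suc-prog a (suc j) = suc-prog (suc (suc a)) j

prog-mono : a ≤ b → i ≤ j → prog a i ≤ prog b j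
prog-mono {a} {b} {i} {j} a≤b i≤j rewrite prog-closed a i | prog-closed b j =
  ℕP.+-mono-≤ (ℕP.+-mono-≤ i≤j i≤j) a≤b

prog-<-suc : ∀ a j → prog a j < prog a (suc j)
prog-<-suc a j =
  ℕP.≤-trans (ℕP.≤-reflexive (suc-prog a j)) (prog-mono {i = j} (ℕP.n≤1+n (suc a)) ℕP.≤-refl)

prog-0 : ∀ r → prog 0 r ≡ 2 ℕ.* r
prog-0 r = trans (prog-closed 0 r) (twice r)
  where
  twice : ∀ r → r + r + 0 ≡ 2 ℕ.* r
  twice = ℕSolver.solve-∀

parity : ∀ p → (∃ λ j → p ≡ prog 0 j) ⊎ (∃ λ j → p ≡ prog 1 j)
parity zero = inj₁ (0 , refl)
parity (suc p) with parity p
... | inj₁ (j , refl) = inj₂ (j , suc-prog 0 j)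
... | inj₂ (j , refl) = inj₁ (suc j , suc-prog 1 j)

prog-index< : ∀ r → 1 ≤ a → prog a j ≤ 2 ℕ.* r → j < r
prog-index< {a} {j} r 1≤a bound with j <? r
... | yes j<r = j<r
... | no j≮r = ⊥-elim (ℕP.<⇒≱ too-big bound)
  where
  open ℕP.≤-Reasoning
  too-big : 2 ℕ.* r < prog a j
  too-big = begin-strict
    2 ℕ.* r       ≡⟨ sym (prog-0 r) ⟩
    prog 0 r      ≤⟨ prog-mono {a = 0} z≤n (ℕP.≮⇒≥ j≮r) ⟩
    prog 0 j      <⟨ ℕP.≤-reflexive (suc-prog 0 j) ⟩
    prog 1 j      ≤⟨ prog-mono {i = j} 1≤a ℕP.≤-refl ⟩
    prog a j      ∎

prog≤2r : ∀ r → a ≤ 2 → j < r → prog a j ≤ 2 ℕ.* r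
prog≤2r {a} {j} r a≤2 j<r = begin
  prog a j          ≤⟨ prog-mono {i = j} a≤2 ℕP.≤-refl ⟩
  prog 0 (suc j)    ≤⟨ prog-mono {a = 0} z≤n j<r ⟩
  prog 0 r          ≡⟨ prog-0 r ⟩
  2 ℕ.* r           ∎
  where open ℕP.≤-Reasoning

Below : (ℕ → ℤ) → (ℕ → ℤ) → ℕ → ℕ → Set
Below g f a k = ∀ j → j < k → g (prog a j) ℤ.≤ f (prog a j)

Below-++ : Below g f a k → Below g f (prog a k) l → Below g f a (k + l)
Below-++ {g} {f} {a} {k} below-k below-l j j<k+l with j <? k
... | yes j<k = below-k j j<k
... | no j≮k with ℕP.m≤n⇒∃[o]m+o≡n (ℕP.≮⇒≥ j≮k)
...   | o , refl = subst (λ p → g p ℤ.≤ f p) (sym (prog-+ a k o)) (below-l o (ℕP.+-cancelˡ-< k o _ j<k+l))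

Below-drop : Below g f a n → i + k ≤ n → Below g f (prog a i) k
Below-drop {g} {f} {a} {i = i} below i+k≤n j j<k =
  subst (λ p → g p ℤ.≤ f p) (prog-+ a i j) (below (i + j) (ℕP.<-≤-trans (ℕP.+-monoʳ-< i j<k) i+k≤n))

-- index of the entry preceding the j-th pair of a block a, a+2, … entered from index b
before : ℕ → ℕ → ℕ → ℕ
before b a zero    = b
before b a (suc j) = prog a j

before-adjacent : ∀ a j → before a (suc (suc a)) j ≡ prog a j
before-adjacent a zero    = refl
before-adjacent a (suc j) = refl

before<prog : b < a → ∀ j → before b a j < prog a j
before<prog b<a zero    = b<a
before<prog b<a (suc j) = prog-<-suc _ j

1≤before : 1 ≤ b → b < a → ∀ j → 1 ≤ before b a j
1≤before 1≤b b<a zero    = 1≤b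
1≤before 1≤b b<a (suc j) = ℕP.≤-trans 1≤b (ℕP.≤-trans (ℕP.<⇒≤ b<a) (prog-mono {i = 0} {j = j} ℕP.≤-refl z≤n))

before≤ : b ≤ c → prog a k ≤ suc (suc c) → before b a k ≤ c
before≤ {k = zero}  b≤c _     = b≤c
before≤ {a = a} {k = suc k} b≤c bound =
  ℕP.≤-pred (ℕP.≤-pred (subst (_≤ _) (prog-suc a k) bound))
  where
  prog-suc : ∀ a k → prog a (suc k) ≡ suc (suc (prog a k))
  prog-suc a k = trans (sym (suc-prog (suc a) k)) (cong suc (sym (suc-prog a k)))

-- Interlacing of lists as the descent of their weave

weave : List ℤ → List ℤ → List ℤ
weave []       ys = ys
weave (x ∷ xs) ys = x ∷ weave ys xs

Descending : List ℤ → Set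
Descending = Linked ℤ._≥_

≺-cons : ∀ {x y z α β} → ((y ∷ β) ≺ (x ∷ z ∷ α)) ⇔ ((y ℤ.≤ x) × (z ℤ.≤ y) × (β ≺ (z ∷ α)))
≺-cons = mk⇔
  (λ (len , h) → proj₁ (h 1 ℕP.≤-refl (s≤s z≤n)) , proj₂ (h 1 ℕP.≤-refl (s≤s z≤n)) ,
                 (ℕP.suc-injective len , λ { (suc ρ) _ ρ≤ → h (suc (suc ρ)) (s≤s z≤n) (s≤s ρ≤) }))
  (λ (y≤x , z≤y , (len , h)) → cong suc len ,
    λ { (suc zero) _ _ → y≤x , z≤y ; (suc (suc ρ)) _ (s≤s ρ≤) → h (suc ρ) (s≤s z≤n) ρ≤ })

≺⇔descending : ∀ α β → length α ≡ suc (length β) → (β ≺ α) ⇔ Descending (weave α β)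
≺⇔descending (x ∷ []) [] _ = mk⇔ (λ _ → [-]) (λ _ → refl , λ { (suc ρ) _ () })
≺⇔descending (x ∷ z ∷ α) (y ∷ β) len = mk⇔
  (λ y≺ → let (y≤x , z≤y , β≺) = Equivalence.to ≺-cons y≺
          in y≤x ∷ z≤y ∷ Equivalence.to rest β≺)
  (λ { (y≤x ∷ z≤y ∷ desc) → Equivalence.from ≺-cons (y≤x , z≤y , Equivalence.from rest desc) })
  where
  rest : (β ≺ (z ∷ α)) ⇔ Descending (weave (z ∷ α) β)
  rest = ≺⇔descending (z ∷ α) β (ℕP.suc-injective len)

pairs : (ℕ → ℤ) → (ℕ → ℤ) → List ℕ → List ℤ
pairs f g []       = []
pairs f g (p ∷ ps) = f p ∷ g p ∷ pairs f g ps

select-++ : ∀ {m} (x : Vec ℤ m) is js → select x (is ++ js) ≡ select x is ++ select x js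
select-++ x []       js = refl
select-++ x (i ∷ is) js = cong (at x i ∷_) (select-++ x is js)

length-select : ∀ {m} (x : Vec ℤ m) is → length (select x is) ≡ length is
length-select x []       = refl
length-select x (i ∷ is) = cong suc (length-select x is)

weave-pairs : ∀ {m} (x y : Vec ℤ m) S α β →
  weave (select x S ++ α) (select y S ++ β) ≡ pairs (at x) (at y) S ++ weave α β
weave-pairs x y []      α β = refl
weave-pairs x y (p ∷ S) α β = cong (λ t → at x p ∷ at y p ∷ t) (weave-pairs x y S α β)

-- the pattern of θ₁' ≺ θ₁:  θ₁ = 1, E, O, M  and  θ₁' = E, c, O
≺⇔shape₁ : ∀ {m} (x y : Vec ℤ m) E c O M →
  (select y (E ++ c ∷ O) ≺ select x (1 ∷ E ++ O ++ M ∷ [])) ⇔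
  Descending (at x 1 ∷ pairs (at y) (at x) E ++ at y c ∷ pairs (at x) (at y) O ++ at x M ∷ [])
≺⇔shape₁ x y E c O M =
  subst (λ l → (select y (E ++ c ∷ O) ≺ select x (1 ∷ E ++ O ++ M ∷ [])) ⇔ Descending l) woven
        (≺⇔descending (select x (1 ∷ E ++ O ++ M ∷ [])) (select y (E ++ c ∷ O)) lengths)
  where
  open ≡-Reasoning
  woven : weave (select x (1 ∷ E ++ O ++ M ∷ [])) (select y (E ++ c ∷ O))
        ≡ at x 1 ∷ pairs (at y) (at x) E ++ at y c ∷ pairs (at x) (at y) O ++ at x M ∷ []
  woven = cong (at x 1 ∷_) (begin
    weave (select y (E ++ c ∷ O)) (select x (E ++ O ++ M ∷ []))
      ≡⟨ cong₂ weave (select-++ y E (c ∷ O)) (select-++ x E (O ++ M ∷ [])) ⟩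
    weave (select y E ++ at y c ∷ select y O) (select x E ++ select x (O ++ M ∷ []))
      ≡⟨ weave-pairs y x E _ _ ⟩
    pairs (at y) (at x) E ++ at y c ∷ weave (select x (O ++ M ∷ [])) (select y O)
      ≡⟨ cong (λ t → pairs (at y) (at x) E ++ at y c ∷ t)
           (cong₂ weave (select-++ x O (M ∷ [])) (sym (ListP.++-identityʳ (select y O)))) ⟩
    pairs (at y) (at x) E ++ at y c ∷ weave (select x O ++ at x M ∷ []) (select y O ++ [])
      ≡⟨ cong (λ t → pairs (at y) (at x) E ++ at y c ∷ t) (weave-pairs x y O _ _) ⟩
    pairs (at y) (at x) E ++ at y c ∷ pairs (at x) (at y) O ++ at x M ∷ [] ∎)
  indices : length (E ++ O ++ M ∷ []) ≡ length (E ++ c ∷ O)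
  indices = begin
    length (E ++ O ++ M ∷ [])           ≡⟨ cong length (sym (ListP.++-assoc E O (M ∷ []))) ⟩
    length ((E ++ O) ++ M ∷ [])         ≡⟨ ListP.length-++-sucʳ (E ++ O) M [] ⟩
    suc (length ((E ++ O) ++ []))       ≡⟨ cong (suc ∘ length) (ListP.++-identityʳ (E ++ O)) ⟩
    suc (length (E ++ O))               ≡⟨ sym (ListP.length-++-sucʳ E c O) ⟩
    length (E ++ c ∷ O)                 ∎
  lengths : length (select x (1 ∷ E ++ O ++ M ∷ [])) ≡ suc (length (select y (E ++ c ∷ O)))
  lengths = trans (length-select x (1 ∷ E ++ O ++ M ∷ []))
                  (cong suc (trans indices (sym (length-select y (E ++ c ∷ O)))))

-- the pattern of θ₂' ≺ θ₂:  θ₂ = O, c, E  and  θ₂' = O, E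
≺⇔shape₂ : ∀ {m} (x y : Vec ℤ m) O c E →
  (select y (O ++ E) ≺ select x (O ++ c ∷ E)) ⇔
  Descending (pairs (at x) (at y) O ++ at x c ∷ pairs (at y) (at x) E)
≺⇔shape₂ x y O c E =
  subst (λ l → (select y (O ++ E) ≺ select x (O ++ c ∷ E)) ⇔ Descending l) woven
        (≺⇔descending (select x (O ++ c ∷ E)) (select y (O ++ E)) lengths)
  where
  open ≡-Reasoning
  woven : weave (select x (O ++ c ∷ E)) (select y (O ++ E))
        ≡ pairs (at x) (at y) O ++ at x c ∷ pairs (at y) (at x) E
  woven = begin
    weave (select x (O ++ c ∷ E)) (select y (O ++ E))
      ≡⟨ cong₂ weave (select-++ x O (c ∷ E)) (select-++ y O E) ⟩
    weave (select x O ++ at x c ∷ select x E) (select y O ++ select y E)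
      ≡⟨ weave-pairs x y O _ _ ⟩
    pairs (at x) (at y) O ++ at x c ∷ weave (select y E) (select x E)
      ≡⟨ cong (λ t → pairs (at x) (at y) O ++ at x c ∷ t)
           (cong₂ weave (sym (ListP.++-identityʳ (select y E))) (sym (ListP.++-identityʳ (select x E)))) ⟩
    pairs (at x) (at y) O ++ at x c ∷ weave (select y E ++ []) (select x E ++ [])
      ≡⟨ cong (λ t → pairs (at x) (at y) O ++ at x c ∷ t)
           (trans (weave-pairs y x E [] []) (ListP.++-identityʳ _)) ⟩
    pairs (at x) (at y) O ++ at x c ∷ pairs (at y) (at x) E ∎
  lengths : length (select x (O ++ c ∷ E)) ≡ suc (length (select y (O ++ E)))
  lengths = trans (length-select x (O ++ c ∷ E))
                  (trans (ListP.length-++-sucʳ O c E) (cong suc (sym (length-select y (O ++ E)))))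

-- Descent through a block of pairs

pairs-descending : ∀ f g b a k ys →
  (∀ j → j < k → f (prog a j) ℤ.≤ g (before b a j)) →
  Below g f a k →
  Descending (g (before b a k) ∷ ys) →
  Descending (g b ∷ pairs f g (step2 a k) ++ ys)
pairs-descending f g b a zero    ys enter below exit = exit
pairs-descending f g b a (suc k) ys enter below exit =
  enter 0 (s≤s z≤n) ∷ below 0 (s≤s z≤n) ∷
  pairs-descending f g a (suc (suc a)) k ys enter′ (λ j → below (suc j) ∘ s≤s) exit′
  where
  enter′ : ∀ j → j < k → f (prog (suc (suc a)) j) ℤ.≤ g (before a (suc (suc a)) j)
  enter′ j j<k = subst (λ p → f (prog a (suc j)) ℤ.≤ g p) (sym (before-adjacent a j))
                       (enter (suc j) (s≤s j<k))
  exit′ : Descending (g (before a (suc (suc a)) k) ∷ ys)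
  exit′ = subst (λ p → Descending (g p ∷ ys)) (sym (before-adjacent a k)) exit

descending-pairs : ∀ f g b a k ys → Descending (g b ∷ pairs f g (step2 a k) ++ ys) →
  Below g f a k × Descending (g (before b a k) ∷ ys)
descending-pairs f g b a zero    ys desc = (λ _ ()) , desc
descending-pairs f g b a (suc k) ys (_ ∷ ga≤fa ∷ desc)
  with descending-pairs f g a (suc (suc a)) k ys desc
... | below , exit =
  (λ { zero _ → ga≤fa ; (suc j) (s≤s j<k) → below j j<k }) ,
  subst (λ p → Descending (g p ∷ ys)) (before-adjacent a k) exit

-- Interlaced decreasing sequences

Decreasing : (ℕ → ℤ) → ℕ → Set
Decreasing F n = ∀ i → 1 ≤ i → i < n → F (suc i) ℤ.≤ F i

antitone : Decreasing F n → 1 ≤ i → i ≤ j → j ≤ n → F j ℤ.≤ F i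
antitone {j = zero}  dec 1≤i i≤j _   = ⊥-elim (ℕP.<⇒≱ 1≤i i≤j)
antitone {j = suc j} dec 1≤i i≤j j<n with ℕP.m≤n⇒m<n∨m≡n i≤j
... | inj₂ refl        = ℤP.≤-refl
... | inj₁ (s≤s i≤j′) =
  ℤP.≤-trans (dec j (ℕP.≤-trans 1≤i i≤j′) j<n) (antitone dec 1≤i i≤j′ (ℕP.≤-trans (ℕP.n≤1+n j) j<n))

Interlaced : (ℕ → ℤ) → (ℕ → ℤ) → ℕ → Set
Interlaced F G r = Below G F 1 r × Below F G 2 r

suc-r<2r : 1 ≤ n → suc n ≤ 2 ℕ.* n
suc-r<2r {n} 1≤n = begin
  suc n      ≡⟨ ℕP.+-comm 1 n ⟩
  n + 1      ≤⟨ ℕP.+-monoʳ-≤ n 1≤n ⟩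
  n + n      ≡⟨ twice n ⟩
  2 ℕ.* n    ∎
  where
  open ℕP.≤-Reasoning
  twice : ∀ n → n + n ≡ 2 ℕ.* n
  twice = ℕSolver.solve-∀

last-even : ∀ r → 1 ≤ 2 ℕ.* r → ∃ λ j → suc j ≡ r × prog 2 j ≡ 2 ℕ.* r
last-even (suc j) _ = j , refl , prog-0 (suc j)

prog-2-r : ∀ r → prog 2 r ≡ suc (suc (2 ℕ.* r))
prog-2-r r = trans (prog-closed 2 r) (twice r)
  where
  twice : ∀ r → r + r + 2 ≡ suc (suc (2 ℕ.* r))
  twice = ℕSolver.solve-∀

sub-block≤2r : ∀ r → a ≤ 2 → i + k ≤ r → j < k → prog (prog a i) j ≤ 2 ℕ.* r
sub-block≤2r {a} {i} {j = j} r a≤2 i+k≤r j<k =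
  subst (_≤ 2 ℕ.* r) (prog-+ a i j) (prog≤2r r a≤2 (ℕP.<-≤-trans (ℕP.+-monoʳ-< i j<k) i+k≤r))

-- The chains encoding θ₁' ≺ θ₁ and θ₂' ≺ θ₂: a block of even-indexed pairs, the entry
-- at r + 1, and a block of odd-indexed pairs (in the other order for θ₂).
chain₁ : (ℕ → ℤ) → (ℕ → ℤ) → (r k₁ i₂ k₂ : ℕ) → List ℤ
chain₁ F G r k₁ i₂ k₂ =
  F 1 ∷ pairs G F (step2 2 k₁) ++ G (suc r) ∷ pairs F G (step2 (prog 1 i₂) k₂) ++ F (2 ℕ.* r) ∷ []

chain₂ : (ℕ → ℤ) → (ℕ → ℤ) → (r k₁ i₂ k₂ : ℕ) → List ℤ
chain₂ F G r k₁ i₂ k₂ =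
  F 1 ∷ G 1 ∷ pairs F G (step2 3 k₁) ++ F (suc r) ∷ pairs G F (step2 (prog 2 i₂) k₂)

-- For decreasing F, G on 1, …, 2r that interlace, every link of the splitting chains descends.
module Zigzag {r : ℕ} {F G : ℕ → ℤ} (decF : Decreasing F (2 ℕ.* r)) (decG : Decreasing G (2 ℕ.* r))
              (odds : Below G F 1 r) (evens : Below F G 2 r) where

  odd-after : ∀ j → suc (prog 2 j) ≤ 2 ℕ.* r → G (suc (prog 2 j)) ℤ.≤ F (suc (prog 2 j))
  odd-after j bound = subst (λ p → G p ℤ.≤ F p) (sym (suc-prog 2 j))
    (odds (suc j) (prog-index< r (s≤s z≤n) (subst (_≤ 2 ℕ.* r) (suc-prog 2 j) bound)))

  later-G≤F : 1 ≤ a → a < b → b ≤ 2 ℕ.* r → G b ℤ.≤ F a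
  later-G≤F {a} {b} 1≤a a<b b≤N with parity a
  ... | inj₁ (suc j , refl) =
    ℤP.≤-trans (antitone decG (s≤s z≤n) a<b b≤N)
      (ℤP.≤-trans (odd-after j (ℕP.≤-trans a<b b≤N)) (decF (prog 2 j) 1≤a (ℕP.≤-trans a<b b≤N)))
  ... | inj₂ (j , refl) =
    ℤP.≤-trans (antitone decG 1≤a (ℕP.<⇒≤ a<b) b≤N)
      (odds j (prog-index< r (s≤s z≤n) (ℕP.≤-trans (ℕP.<⇒≤ a<b) b≤N)))

  after-even : ∀ j → 1 ≤ b → b ≤ prog 2 j → suc (prog 2 j) ≤ 2 ℕ.* r → F (suc (prog 2 j)) ℤ.≤ G b
  after-even j 1≤b b≤q q<N =
    ℤP.≤-trans (decF (prog 2 j) (ℕP.≤-trans 1≤b b≤q) q<N)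
      (ℤP.≤-trans (evens j (prog-index< r (s≤s z≤n) q≤N)) (antitone decG 1≤b b≤q q≤N))
    where
    q≤N : prog 2 j ≤ 2 ℕ.* r
    q≤N = ℕP.≤-trans (ℕP.n≤1+n _) q<N

  later-F≤G : 1 ≤ b → b < c → c ≤ 2 ℕ.* r → F c ℤ.≤ G b
  later-F≤G {b} {c} 1≤b b<c c≤N with parity c
  ... | inj₁ (suc j , refl) =
    ℤP.≤-trans (evens j (prog-index< r (s≤s z≤n) c≤N)) (antitone decG 1≤b (ℕP.<⇒≤ b<c) c≤N)
  ... | inj₂ (zero , refl)  = ⊥-elim (ℕP.<⇒≱ b<c 1≤b)
  ... | inj₂ (suc j , refl) = subst (λ p → F p ℤ.≤ G b) (suc-prog 2 j)
    (after-even j 1≤b (ℕP.≤-pred (subst (b <_) (sym (suc-prog 2 j)) b<c))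
                      (subst (_≤ 2 ℕ.* r) (sym (suc-prog 2 j)) c≤N))

  F-last≤G : 1 ≤ b → b ≤ 2 ℕ.* r → F (2 ℕ.* r) ℤ.≤ G b
  F-last≤G {b} 1≤b b≤N with last-even r (ℕP.≤-trans 1≤b b≤N)
  ... | j , suc-j≡r , last = subst (λ p → F p ℤ.≤ G b) last
    (ℤP.≤-trans (evens j (ℕP.≤-reflexive suc-j≡r))
                (antitone decG 1≤b (subst (b ≤_) (sym last) b≤N) (ℕP.≤-reflexive last)))

  evenBlock : ∀ b i k ys → 1 ≤ b → b < prog 2 i → i + k ≤ r →
    Descending (F (before b (prog 2 i) k) ∷ ys) →
    Descending (F b ∷ pairs G F (step2 (prog 2 i) k) ++ ys)
  evenBlock b i k ys 1≤b b<a i+k≤r exit =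
    pairs-descending G F b (prog 2 i) k ys enter (Below-drop {g = F} {f = G} {a = 2} evens i+k≤r) exit
    where
    enter : ∀ j → j < k → G (prog (prog 2 i) j) ℤ.≤ F (before b (prog 2 i) j)
    enter j j<k = later-G≤F (1≤before 1≤b b<a j) (before<prog b<a j) (sub-block≤2r r ℕP.≤-refl i+k≤r j<k)

  oddBlock : ∀ b i k ys → 1 ≤ b → b < prog 1 i → i + k ≤ r →
    Descending (G (before b (prog 1 i) k) ∷ ys) →
    Descending (G b ∷ pairs F G (step2 (prog 1 i) k) ++ ys)
  oddBlock b i k ys 1≤b b<a i+k≤r exit =
    pairs-descending F G b (prog 1 i) k ys enter (Below-drop {g = G} {f = F} {a = 1} odds i+k≤r) exit
    where
    enter : ∀ j → j < k → F (prog (prog 1 i) j) ℤ.≤ G (before b (prog 1 i) j)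
    enter j j<k = later-F≤G (1≤before 1≤b b<a j) (before<prog b<a j) (sub-block≤2r r (s≤s z≤n) i+k≤r j<k)

  descending-chain₁ : ∀ k₁ i₂ k₂ → 1 ≤ r → k₁ ≤ r → before 1 2 k₁ ≤ r → suc r < prog 1 i₂ → i₂ + k₂ ≤ r →
    Descending (chain₁ F G r k₁ i₂ k₂)
  descending-chain₁ k₁ i₂ k₂ 1≤r k₁≤r e≤r r<a i+k≤r =
    evenBlock 1 0 k₁ _ ℕP.≤-refl (s≤s (s≤s z≤n)) k₁≤r
      (later-G≤F (1≤before ℕP.≤-refl (s≤s (s≤s z≤n)) k₁) (s≤s e≤r) r<N ∷
       oddBlock (suc r) i₂ k₂ _ (s≤s z≤n) r<a i+k≤r
         (F-last≤G (1≤before (s≤s z≤n) r<a k₂) (before≤ {a = prog 1 i₂} {k = k₂} r<N last≤) ∷ [-]))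
    where
    r<N : suc r ≤ 2 ℕ.* r
    r<N = suc-r<2r 1≤r
    last≤ : prog (prog 1 i₂) k₂ ≤ suc (suc (2 ℕ.* r))
    last≤ = subst₂ _≤_ (prog-+ 1 i₂ k₂) (prog-2-r r) (prog-mono {a = 1} {b = 2} (s≤s z≤n) i+k≤r)

  descending-chain₂ : ∀ k₁ i₂ k₂ → suc k₁ ≤ r → before 1 3 k₁ ≤ r → suc r < prog 2 i₂ → i₂ + k₂ ≤ r →
    Descending (chain₂ F G r k₁ i₂ k₂)
  descending-chain₂ k₁ i₂ k₂ k₁<r e≤r r<a i+k≤r =
    odds 0 1≤r ∷ oddBlock 1 1 k₁ _ ℕP.≤-refl (s≤s (s≤s z≤n)) k₁<r
      (later-F≤G (1≤before ℕP.≤-refl (s≤s (s≤s z≤n)) k₁) (s≤s e≤r) (suc-r<2r 1≤r) ∷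
       subst Descending (ListP.++-identityʳ _) (evenBlock (suc r) i₂ k₂ [] (s≤s z≤n) r<a i+k≤r [-]))
    where
    1≤r : 1 ≤ r
    1≤r = ℕP.≤-trans (s≤s z≤n) k₁<r

chain₁-below : ∀ r k₁ i₂ k₂ → Descending (chain₁ F G r k₁ i₂ k₂) →
  Below F G 2 k₁ × G (suc r) ℤ.≤ F (before 1 2 k₁) × Below G F (prog 1 i₂) k₂
chain₁-below {F} {G} r k₁ i₂ k₂ desc with descending-pairs G F 1 2 k₁ _ desc
... | belowE , (link ∷ rest) = belowE , link , proj₁ (descending-pairs F G (suc r) (prog 1 i₂) k₂ _ rest)

chain₂-below : ∀ r k₁ i₂ k₂ → Descending (chain₂ F G r k₁ i₂ k₂) →
  Below G F 1 (suc k₁) × F (suc r) ℤ.≤ G (before 1 3 k₁) × Below F G (prog 2 i₂) k₂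
chain₂-below {F} {G} r k₁ i₂ k₂ (g1≤f1 ∷ desc) with descending-pairs F G 1 3 k₁ _ desc
... | belowO , (link ∷ rest) =
  (λ { zero _ → g1≤f1 ; (suc j) (s≤s j<k) → belowO j j<k }) , link ,
  proj₁ (descending-pairs G F (suc r) (prog 2 i₂) k₂ [] (subst Descending (sym (ListP.++-identityʳ _)) rest))

-- Adding dℓ

at-lookup : ∀ {m} (x : Vec ℤ m) i (i<m : i < m) → at x (suc i) ≡ lookup x (fromℕ< i<m)
at-lookup (e ∷ x) zero    _   = refl
at-lookup (e ∷ x) (suc i) i<m = at-lookup x i (ℕP.≤-pred i<m)

at-addℓ : ∀ r d (x : Vec ℤ (2 ℕ.* r)) i (i<2r : i < 2 ℕ.* r) →
  at (addℓ r d x) (suc i) ≡ at x (suc i) ℤ.+ (if r ℕ.≤ᵇ i then d else 0ℤ)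
at-addℓ r d x i i<2r = begin
  at (addℓ r d x) (suc i)                      ≡⟨ at-lookup (addℓ r d x) i i<2r ⟩
  lookup (addℓ r d x) (fromℕ< i<2r)            ≡⟨ lookup∘tabulate _ (fromℕ< i<2r) ⟩
  lookup x (fromℕ< i<2r) ℤ.+ (if r ℕ.≤ᵇ toℕ (fromℕ< i<2r) then d else 0ℤ)
    ≡⟨ cong₂ (λ e k → e ℤ.+ (if r ℕ.≤ᵇ k then d else 0ℤ)) (sym (at-lookup x i i<2r)) (toℕ-fromℕ< i<2r) ⟩
  at x (suc i) ℤ.+ (if r ℕ.≤ᵇ i then d else 0ℤ) ∎
  where open ≡-Reasoning

addℓ-low : ∀ r d (x : Vec ℤ (2 ℕ.* r)) p → 1 ≤ p → p ≤ r → at (addℓ r d x) p ≡ at x p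
addℓ-low r d x (suc i) _ i<r = begin
  at (addℓ r d x) (suc i)                         ≡⟨ at-addℓ r d x i (ℕP.<-≤-trans i<r (ℕP.m≤m+n r _)) ⟩
  at x (suc i) ℤ.+ (if r ℕ.≤ᵇ i then d else 0ℤ)  ≡⟨ cong (λ b → at x (suc i) ℤ.+ (if b then d else 0ℤ)) below ⟩
  at x (suc i) ℤ.+ 0ℤ                             ≡⟨ ℤP.+-identityʳ _ ⟩
  at x (suc i)                                    ∎
  where
  open ≡-Reasoning
  below : (r ℕ.≤ᵇ i) ≡ false
  below = ¬-not (λ r≤ᵇi → ℕP.<⇒≱ i<r (ℕP.≤ᵇ⇒≤ r i (Equivalence.from T-≡ r≤ᵇi)))

addℓ-high : ∀ r d (x : Vec ℤ (2 ℕ.* r)) p → r < p → p ≤ 2 ℕ.* r → at (addℓ r d x) p ≡ at x p ℤ.+ d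
addℓ-high r d x (suc i) (s≤s r≤i) i<2r =
  trans (at-addℓ r d x i i<2r)
        (cong (λ b → at x (suc i) ℤ.+ (if b then d else 0ℤ)) (Equivalence.to T-≡ (ℕP.≤⇒≤ᵇ r≤i)))

+-cancelʳ-≤ : ∀ {e f} d → e ℤ.+ d ℤ.≤ f ℤ.+ d → e ℤ.≤ f
+-cancelʳ-≤ {e} {f} d le = subst₂ ℤ._≤_ (undo e d) (undo f d) (ℤP.+-monoˡ-≤ (ℤ.- d) le)
  where
  undo : ∀ e d → e ℤ.+ d ℤ.- d ≡ e
  undo = ℤSolver.solve-∀

-- both vectors are shifted by the same amount, so comparisons are unchanged
addℓ-≤⇔ : ∀ r d (x y : Vec ℤ (2 ℕ.* r)) p → 1 ≤ p → p ≤ 2 ℕ.* r →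
  (at x p ℤ.≤ at y p) ⇔ (at (addℓ r d x) p ℤ.≤ at (addℓ r d y) p)
addℓ-≤⇔ r d x y p 1≤p p≤2r with p ≤? r
... | yes p≤r rewrite addℓ-low r d x p 1≤p p≤r | addℓ-low r d y p 1≤p p≤r = mk⇔ (λ le → le) (λ le → le)
... | no p≰r rewrite addℓ-high r d x p (ℕP.≰⇒> p≰r) p≤2r | addℓ-high r d y p (ℕP.≰⇒> p≰r) p≤2r =
  mk⇔ (ℤP.+-monoˡ-≤ d) (+-cancelʳ-≤ d)

addℓ-Interlaced⇔ : ∀ r d (x y : Vec ℤ (2 ℕ.* r)) →
  Interlaced (at x) (at y) r ⇔ Interlaced (at (addℓ r d x)) (at (addℓ r d y)) r
addℓ-Interlaced⇔ r d x y = mk⇔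
  (λ (odds , evens) → (λ j j<r → Equivalence.to (oddAt j j<r) (odds j j<r)) ,
                    (λ j j<r → Equivalence.to (evenAt j j<r) (evens j j<r)))
  (λ (odds , evens) → (λ j j<r → Equivalence.from (oddAt j j<r) (odds j j<r)) ,
                    (λ j j<r → Equivalence.from (evenAt j j<r) (evens j j<r)))
  where
  x̂ ŷ : Vec ℤ (2 ℕ.* r)
  x̂ = addℓ r d x
  ŷ = addℓ r d y
  oddAt : ∀ j → j < r → (at y (prog 1 j) ℤ.≤ at x (prog 1 j)) ⇔ (at ŷ (prog 1 j) ℤ.≤ at x̂ (prog 1 j))
  oddAt j j<r = addℓ-≤⇔ r d y x (prog 1 j) (prog-mono {i = 0} {j = j} ℕP.≤-refl z≤n) (prog≤2r r (s≤s z≤n) j<r)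
  evenAt : ∀ j → j < r → (at x (prog 2 j) ℤ.≤ at y (prog 2 j)) ⇔ (at x̂ (prog 2 j) ℤ.≤ at ŷ (prog 2 j))
  evenAt j j<r = addℓ-≤⇔ r d x y (prog 2 j) (prog-mono {i = 0} {j = j} (s≤s z≤n) z≤n) (prog≤2r r ℕP.≤-refl j<r)

addℓ-decreasing : ∀ r d (x : Vec ℤ (2 ℕ.* r)) → Decreasing (at x) (2 ℕ.* r) → d ℤ.≤ defect r x →
  Decreasing (at (addℓ r d x)) (2 ℕ.* r)
addℓ-decreasing r d x dec d≤defect i 1≤i i<2r with ℕP.<-cmp i r
... | tri< i<r _ _
  rewrite addℓ-low r d x (suc i) (s≤s z≤n) i<r | addℓ-low r d x i 1≤i (ℕP.<⇒≤ i<r) = dec i 1≤i i<2r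
... | tri> _ _ r<i
  rewrite addℓ-high r d x (suc i) (ℕP.m<n⇒m<1+n r<i) i<2r | addℓ-high r d x i r<i (ℕP.<⇒≤ i<2r) =
  ℤP.+-monoˡ-≤ d (dec i 1≤i i<2r)
... | tri≈ _ refl _
  rewrite addℓ-high r d x (suc r) (ℕP.n<1+n r) i<2r | addℓ-low r d x r 1≤i ℕP.≤-refl =
  subst (at x (suc r) ℤ.+ d ℤ.≤_) (restore (at x (suc r)) (at x r)) (ℤP.+-monoʳ-≤ (at x (suc r)) d≤defect)
  where
  restore : ∀ e f → e ℤ.+ (f ℤ.- e) ≡ f
  restore = ℤSolver.solve-∀

defect-addℓ : ∀ r d (x : Vec ℤ (2 ℕ.* r)) → 1 ≤ r → defect r (addℓ r d x) ≡ defect r x ℤ.- d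
defect-addℓ r d x 1≤r
  rewrite addℓ-low r d x r 1≤r ℕP.≤-refl | addℓ-high r d x (suc r) ℕP.≤-refl (suc-r<2r 1≤r) =
  regroup (at x r) (at x (suc r)) d
  where
  regroup : ∀ e f d → e ℤ.- (f ℤ.+ d) ≡ e ℤ.- f ℤ.- d
  regroup = ℤSolver.solve-∀

defect-≤ : ∀ r (x y : Vec ℤ (2 ℕ.* r)) → at x r ℤ.≤ at y r → at y (suc r) ℤ.≤ at x (suc r) →
  defect r x ℤ.≤ defect r y
defect-≤ r x y xr≤yr ysr≤xsr = ℤP.+-mono-≤ xr≤yr (ℤP.neg-mono-≤ ysr≤xsr)

-- The splitting maps for even and odd r

even-double : ∀ k → even (k + k) ≡ true
even-double zero    = refl
even-double (suc k) rewrite ℕP.+-suc k k = even-double k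

half-double : ∀ k → half (k + k) ≡ k
half-double zero    = refl
half-double (suc k) rewrite ℕP.+-suc k k = cong suc (half-double k)

even-odd : ∀ k → even (suc (k + k)) ≡ false
even-odd zero    = refl
even-odd (suc k) rewrite ℕP.+-suc k k = even-odd k

half-odd : ∀ k → half (suc (k + k)) ≡ k
half-odd zero    = refl
half-odd (suc k) rewrite ℕP.+-suc k k = cong suc (half-odd k)

r-parity : ∀ r → 1 ≤ r → (∃ λ n → r ≡ suc n + suc n) ⊎ (∃ λ m → r ≡ suc (m + m))
r-parity r 1≤r with parity r
... | inj₁ (zero , refl) = ⊥-elim (ℕP.<⇒≱ 1≤r z≤n)
... | inj₁ (suc n , r≡) = inj₁ (n , trans r≡ (trans (prog-closed 0 (suc n)) (ℕP.+-identityʳ _)))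
... | inj₂ (m , r≡)     = inj₂ (m , trans r≡ (trans (prog-closed 1 m) (ℕP.+-comm _ 1)))

step2-snoc : ∀ a k L → step2 a (suc k) ++ L ≡ step2 a k ++ prog a k ∷ L
step2-snoc a zero    L = refl
step2-snoc a (suc k) L = cong (a ∷_) (step2-snoc (suc (suc a)) k L)

θ₁ix-at : ∀ r {b h} → even r ≡ b → half r ≡ h → θ₁ix r ≡
  (if b then (1 ∷ step2 2 h) ++ (step2 (3 + r) (h ∸ 1) ++ (2 ℕ.* r ∷ []))
        else (1 ∷ step2 2 h) ++ (step2 (2 + r) h ++ (2 ℕ.* r ∷ [])))
θ₁ix-at r refl refl = refl

θ₂ix-at : ∀ r {b h} → even r ≡ b → half r ≡ h → θ₂ix r ≡
  (if b then step2 1 h ++ (suc r ∷ step2 (2 + r) h)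
        else step2 1 (suc h) ++ step2 (suc r) (suc h))
θ₂ix-at r refl refl = refl

θ₁'ix-at : ∀ r {b h} → even r ≡ b → half r ≡ h → θ₁'ix r ≡
  (if b then step2 2 h ++ step2 (suc r) h
        else step2 2 (suc h) ++ step2 (2 + r) h)
θ₁'ix-at r refl refl = refl

θ₂'ix-at : ∀ r {b h} → even r ≡ b → half r ≡ h → θ₂'ix r ≡
  (if b then step2 1 h ++ step2 (2 + r) h
        else step2 1 (suc h) ++ step2 (3 + r) h)
θ₂'ix-at r refl refl = refl

≺⇔chain₁ : ∀ r k₁ i₂ k₂ (x y : Vec ℤ (2 ℕ.* r)) →
  θ₁ix r ≡ 1 ∷ step2 2 k₁ ++ step2 (prog 1 i₂) k₂ ++ 2 ℕ.* r ∷ [] →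
  θ₁'ix r ≡ step2 2 k₁ ++ suc r ∷ step2 (prog 1 i₂) k₂ →
  (θ₁' r y ≺ θ₁ r x) ⇔ Descending (chain₁ (at x) (at y) r k₁ i₂ k₂)
≺⇔chain₁ r k₁ i₂ k₂ x y θ₁≡ θ₁'≡ =
  subst₂ (λ A B → (select y B ≺ select x A) ⇔ Descending (chain₁ (at x) (at y) r k₁ i₂ k₂))
         (sym θ₁≡) (sym θ₁'≡) (≺⇔shape₁ x y (step2 2 k₁) (suc r) (step2 (prog 1 i₂) k₂) (2 ℕ.* r))

≺⇔chain₂ : ∀ r k₁ i₂ k₂ (x y : Vec ℤ (2 ℕ.* r)) →
  θ₂ix r ≡ step2 1 (suc k₁) ++ suc r ∷ step2 (prog 2 i₂) k₂ →
  θ₂'ix r ≡ step2 1 (suc k₁) ++ step2 (prog 2 i₂) k₂ →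
  (θ₂' r y ≺ θ₂ r x) ⇔ Descending (chain₂ (at x) (at y) r k₁ i₂ k₂)
≺⇔chain₂ r k₁ i₂ k₂ x y θ₂≡ θ₂'≡ =
  subst₂ (λ A B → (select y B ≺ select x A) ⇔ Descending (chain₂ (at x) (at y) r k₁ i₂ k₂))
         (sym θ₂≡) (sym θ₂'≡) (≺⇔shape₂ x y (step2 1 (suc k₁)) (suc r) (step2 (prog 2 i₂) k₂))

-- r = 2(n+1): the blocks are E = 2, …, r and O = r+3, …, 2r-1 for θ₁,
-- O = 1, …, r-1 and E = r+2, …, 2r for θ₂
module EvenR (n : ℕ) where
  r : ℕ
  r = suc n + suc n

  three+r : 3 + r ≡ prog 1 (suc (suc n))
  three+r = trans (arith n) (sym (prog-closed 1 (suc (suc n))))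
    where
    arith : ∀ n → 3 + (suc n + suc n) ≡ suc (suc n) + suc (suc n) + 1
    arith = ℕSolver.solve-∀

  two+r : 2 + r ≡ prog 2 (suc n)
  two+r = trans (arith n) (sym (prog-closed 2 (suc n)))
    where
    arith : ∀ n → 2 + (suc n + suc n) ≡ suc n + suc n + 2
    arith = ℕSolver.solve-∀

  prog-2-n : prog 2 n ≡ r
  prog-2-n = trans (prog-closed 2 n) (arith n)
    where
    arith : ∀ n → n + n + 2 ≡ suc n + suc n
    arith = ℕSolver.solve-∀

  prog-1-n : prog 1 (suc n) ≡ suc r
  prog-1-n = trans (prog-closed 1 (suc n)) (arith n)
    where
    arith : ∀ n → suc n + suc n + 1 ≡ suc (suc n + suc n)
    arith = ℕSolver.solve-∀

  θ₁ix≡ : θ₁ix r ≡ 1 ∷ step2 2 (suc n) ++ step2 (prog 1 (suc (suc n))) n ++ 2 ℕ.* r ∷ []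
  θ₁ix≡ = trans (θ₁ix-at r (even-double (suc n)) (half-double (suc n)))
                (cong (λ a → 1 ∷ step2 2 (suc n) ++ step2 a n ++ 2 ℕ.* r ∷ []) three+r)

  θ₁'ix≡ : θ₁'ix r ≡ step2 2 (suc n) ++ suc r ∷ step2 (prog 1 (suc (suc n))) n
  θ₁'ix≡ = trans (θ₁'ix-at r (even-double (suc n)) (half-double (suc n)))
                 (cong (λ a → step2 2 (suc n) ++ suc r ∷ step2 a n) three+r)

  θ₂ix≡ : θ₂ix r ≡ step2 1 (suc n) ++ suc r ∷ step2 (prog 2 (suc n)) (suc n)
  θ₂ix≡ = trans (θ₂ix-at r (even-double (suc n)) (half-double (suc n)))
                (cong (λ a → step2 1 (suc n) ++ suc r ∷ step2 a (suc n)) two+r)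

  θ₂'ix≡ : θ₂'ix r ≡ step2 1 (suc n) ++ step2 (prog 2 (suc n)) (suc n)
  θ₂'ix≡ = trans (θ₂'ix-at r (even-double (suc n)) (half-double (suc n)))
                 (cong (λ a → step2 1 (suc n) ++ step2 a (suc n)) two+r)

-- r = 2m+1: the blocks are E = 2, …, r-1 and O = r+2, …, 2r-1 for θ₁,
-- O = 1, …, r and E = r+3, …, 2r for θ₂
module OddR (m : ℕ) where
  r : ℕ
  r = suc (m + m)

  two+r : 2 + r ≡ prog 1 (suc m)
  two+r = trans (arith m) (sym (prog-closed 1 (suc m)))
    where
    arith : ∀ m → 2 + suc (m + m) ≡ suc m + suc m + 1
    arith = ℕSolver.solve-∀

  three+r : 3 + r ≡ prog 2 (suc m)
  three+r = trans (arith m) (sym (prog-closed 2 (suc m)))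
    where
    arith : ∀ m → 3 + suc (m + m) ≡ suc m + suc m + 2
    arith = ℕSolver.solve-∀

  prog-2-m : prog 2 m ≡ suc r
  prog-2-m = trans (prog-closed 2 m) (arith m)
    where
    arith : ∀ m → m + m + 2 ≡ suc (suc (m + m))
    arith = ℕSolver.solve-∀

  prog-1-m : prog 1 m ≡ r
  prog-1-m = trans (prog-closed 1 m) (ℕP.+-comm _ 1)

  θ₁ix≡ : θ₁ix r ≡ 1 ∷ step2 2 m ++ step2 (prog 1 (suc m)) m ++ 2 ℕ.* r ∷ []
  θ₁ix≡ = trans (θ₁ix-at r (even-odd m) (half-odd m))
                (cong (λ a → 1 ∷ step2 2 m ++ step2 a m ++ 2 ℕ.* r ∷ []) two+r)

  θ₁'ix≡ : θ₁'ix r ≡ step2 2 m ++ suc r ∷ step2 (prog 1 (suc m)) m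
  θ₁'ix≡ = begin
    θ₁'ix r                                       ≡⟨ θ₁'ix-at r (even-odd m) (half-odd m) ⟩
    step2 2 (suc m) ++ step2 (2 + r) m            ≡⟨ step2-snoc 2 m _ ⟩
    step2 2 m ++ prog 2 m ∷ step2 (2 + r) m       ≡⟨ cong₂ (λ c a → step2 2 m ++ c ∷ step2 a m) prog-2-m two+r ⟩
    step2 2 m ++ suc r ∷ step2 (prog 1 (suc m)) m ∎
    where open ≡-Reasoning

  θ₂ix≡ : θ₂ix r ≡ step2 1 (suc m) ++ suc r ∷ step2 (prog 2 (suc m)) m
  θ₂ix≡ = trans (θ₂ix-at r (even-odd m) (half-odd m))
                (cong (λ a → step2 1 (suc m) ++ suc r ∷ step2 a m) three+r)

  θ₂'ix≡ : θ₂'ix r ≡ step2 1 (suc m) ++ step2 (prog 2 (suc m)) m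
  θ₂'ix≡ = trans (θ₂'ix-at r (even-odd m) (half-odd m))
                 (cong (λ a → step2 1 (suc m) ++ step2 a m) three+r)

-- the interlacing of the corollary is Interlaced u v; its middle inequality holds as v decreases
interlacing⇔Interlaced : ∀ r (u v : Vec ℤ (2 ℕ.* r)) → Decreasing (at v) (2 ℕ.* r) →
  (∀ ρ → 1 ℕ.≤ ρ → ρ ℕ.≤ r →
     (at v (2 ℕ.* ρ ∸ 1) ℤ.≤ at u (2 ℕ.* ρ ∸ 1))
     × (at v (2 ℕ.* ρ) ℤ.≤ at v (2 ℕ.* ρ ∸ 1))
     × (at u (2 ℕ.* ρ) ℤ.≤ at v (2 ℕ.* ρ)))
  ⇔ Interlaced (at u) (at v) r
interlacing⇔Interlaced r u v decv = mk⇔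
  (λ L → (λ j j<r → subst (λ p → at v p ℤ.≤ at u p) (odd-index j) (proj₁ (L (suc j) (s≤s z≤n) j<r))) ,
         (λ j j<r → subst (λ p → at u p ℤ.≤ at v p) (even-index j) (proj₂ (proj₂ (L (suc j) (s≤s z≤n) j<r)))))
  (λ { (odds , evens) (suc j) _ j<r →
         subst (λ p → at v p ℤ.≤ at u p) (sym (odd-index j)) (odds j j<r) ,
         subst₂ (λ p q → at v p ℤ.≤ at v q) (sym (even-index j)) (sym (odd-index j)) (middle j j<r) ,
         subst (λ p → at u p ℤ.≤ at v p) (sym (even-index j)) (evens j j<r) })
  where
  odd-index : ∀ j → 2 ℕ.* suc j ∸ 1 ≡ prog 1 j
  odd-index j = trans (cong (_∸ 1) (arith j)) (sym (prog-closed 1 j))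
    where
    arith : ∀ j → 2 ℕ.* suc j ≡ suc (j + j + 1)
    arith = ℕSolver.solve-∀
  even-index : ∀ j → 2 ℕ.* suc j ≡ prog 2 j
  even-index j = trans (arith j) (sym (prog-closed 2 j))
    where
    arith : ∀ j → 2 ℕ.* suc j ≡ j + j + 2
    arith = ℕSolver.solve-∀
  middle : ∀ j → j < r → at v (prog 2 j) ℤ.≤ at v (prog 1 j)
  middle j j<r = subst (λ p → at v p ℤ.≤ at v (prog 1 j)) (suc-prog 1 j)
    (decv (prog 1 j) (prog-mono {i = 0} {j = j} ℕP.≤-refl z≤n)
          (subst (_≤ 2 ℕ.* r) (sym (suc-prog 1 j)) (prog≤2r r ℕP.≤-refl j<r)))

module Splitting (r : ℕ) (1≤r : 1 ≤ r) (u v : Vec ℤ (2 ℕ.* r))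
                 (decu : Decreasing (at u) (2 ℕ.* r)) (decv : Decreasing (at v) (2 ℕ.* r)) where

  d : ℤ
  d = defect r u ⊓ defect r v

  û v̂ : Vec ℤ (2 ℕ.* r)
  û = addℓ r d u
  v̂ = addℓ r d v

  X Y : ℕ → ℤ
  X = at û
  Y = at v̂

  Conditions : Bool → Set
  Conditions b = (if b then defect r û ≡ 0ℤ else defect r v̂ ≡ 0ℤ)
                 × (θ₁' r v̂ ≺ θ₁ r û) × (θ₂' r v̂ ≺ θ₂ r û)

  decX : Decreasing X (2 ℕ.* r)
  decX = addℓ-decreasing r d u decu (ℤP.i⊓j≤i _ _)

  decY : Decreasing Y (2 ℕ.* r)
  decY = addℓ-decreasing r d v decv (ℤP.i⊓j≤j _ _)

  hats : Interlaced (at u) (at v) r ⇔ Interlaced X Y r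
  hats = addℓ-Interlaced⇔ r d u v

  hat-defect-0 : ∀ x → defect r x ≡ d → defect r (addℓ r d x) ≡ 0ℤ
  hat-defect-0 x defect≡d = trans (defect-addℓ r d x 1≤r) (trans (cong (ℤ._- d) defect≡d) (ℤP.+-inverseʳ d))

  flat : ∀ x → defect r x ≡ 0ℤ → at x r ≡ at x (suc r)
  flat x = ℤP.i-j≡0⇒i≡j _ _

  -- r = 2(n+1): d is the defect of u; the chains have blocks of sizes n+1, n and n, n+1
  even-case : ∀ n → r ≡ suc n + suc n → Interlaced (at u) (at v) r ⇔ Conditions true
  even-case n refl = mk⇔ to from
    where
    open EvenR n using (prog-2-n; prog-1-n; three+r; two+r; θ₁ix≡; θ₁'ix≡; θ₂ix≡; θ₂'ix≡)
    C₁ : (θ₁' r v̂ ≺ θ₁ r û) ⇔ Descending (chain₁ X Y r (suc n) (suc (suc n)) n)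
    C₁ = ≺⇔chain₁ r (suc n) (suc (suc n)) n û v̂ θ₁ix≡ θ₁'ix≡
    C₂ : (θ₂' r v̂ ≺ θ₂ r û) ⇔ Descending (chain₂ X Y r n (suc n) (suc n))
    C₂ = ≺⇔chain₂ r n (suc n) (suc n) û v̂ θ₂ix≡ θ₂'ix≡

    to : Interlaced (at u) (at v) r → Conditions true
    to I@(odds , evens) =
      hat-defect-0 u (sym (ℤP.i≤j⇒i⊓j≡i u≤v)) ,
      Equivalence.from C₁ (descending-chain₁ (suc n) (suc (suc n)) n 1≤r (ℕP.m≤m+n (suc n) (suc n))
        (ℕP.≤-reflexive prog-2-n) (subst (suc r <_) three+r (ℕP.n≤1+n _))
        (ℕP.≤-reflexive (cong suc (sym (ℕP.+-suc n n))))) ,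
      Equivalence.from C₂ (descending-chain₂ n (suc n) (suc n) (ℕP.m≤m+n (suc n) (suc n))
        (subst (_≤ r) (sym (before-adjacent 1 n)) (ℕP.≤-pred (subst (prog 1 n <_) prog-1-n (prog-<-suc 1 n))))
        (subst (suc r <_) two+r ℕP.≤-refl) ℕP.≤-refl)
      where
      open Zigzag decX decY (proj₁ (Equivalence.to hats I)) (proj₂ (Equivalence.to hats I))
      u≤v : defect r u ℤ.≤ defect r v
      u≤v = defect-≤ r u v
        (subst (λ p → at u p ℤ.≤ at v p) prog-2-n (evens n (ℕP.m≤m+n (suc n) (suc n))))
        (subst (λ p → at v p ℤ.≤ at u p) prog-1-n (odds (suc n) (s≤s (ℕP.m≤n+m (suc n) n))))

    from : Conditions true → Interlaced (at u) (at v) r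
    from (D , ch₁ , ch₂) with chain₁-below r (suc n) (suc (suc n)) n (Equivalence.to C₁ ch₁)
                            | chain₂-below r n (suc n) (suc n) (Equivalence.to C₂ ch₂)
    ... | E₁ , link , O₁ | O₂ , _ , E₂ =
      Equivalence.from hats (subst (Below Y X 1) count odd-all , Below-++ {g = X} {f = Y} {a = 2} E₁ E₂)
      where
      -- the odd index r + 1, not covered by the pairs of the chains
      middle : Below Y X (prog 1 (suc n)) 1
      middle zero _ = subst (λ p → Y p ℤ.≤ X p) (sym prog-1-n)
        (subst (Y (suc r) ℤ.≤_) (trans (cong X prog-2-n) (flat û D)) link)
      middle (suc j) (s≤s ())
      odd-all : Below Y X 1 (suc n + 1 + n)
      odd-all = Below-++ {g = Y} {f = X} {a = 1} (Below-++ {g = Y} {f = X} {a = 1} O₂ middle)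
        (subst (λ a → Below Y X (prog 1 a) n) (ℕP.+-comm 1 (suc n)) O₁)
      count : suc n + 1 + n ≡ r
      count = arith n
        where
        arith : ∀ n → suc n + 1 + n ≡ suc n + suc n
        arith = ℕSolver.solve-∀

  -- r = 2m+1: d is the defect of v; both chains have blocks of sizes m, m
  odd-case : ∀ m → r ≡ suc (m + m) → Interlaced (at u) (at v) r ⇔ Conditions false
  odd-case m refl = mk⇔ to from
    where
    open OddR m using (prog-2-m; prog-1-m; two+r; three+r; θ₁ix≡; θ₁'ix≡; θ₂ix≡; θ₂'ix≡)
    C₁ : (θ₁' r v̂ ≺ θ₁ r û) ⇔ Descending (chain₁ X Y r m (suc m) m)
    C₁ = ≺⇔chain₁ r m (suc m) m û v̂ θ₁ix≡ θ₁'ix≡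
    C₂ : (θ₂' r v̂ ≺ θ₂ r û) ⇔ Descending (chain₂ X Y r m (suc m) m)
    C₂ = ≺⇔chain₂ r m (suc m) m û v̂ θ₂ix≡ θ₂'ix≡
    m<r : m < r
    m<r = s≤s (ℕP.m≤m+n m m)

    to : Interlaced (at u) (at v) r → Conditions false
    to I@(odds , evens) =
      hat-defect-0 v (sym (ℤP.i≥j⇒i⊓j≡j v≤u)) ,
      Equivalence.from C₁ (descending-chain₁ m (suc m) m 1≤r (ℕP.<⇒≤ m<r)
        (before≤ {a = 2} {k = m} 1≤r (ℕP.≤-trans (ℕP.≤-reflexive prog-2-m) (ℕP.n≤1+n _)))
        (subst (suc r <_) two+r ℕP.≤-refl) ℕP.≤-refl) ,
      Equivalence.from C₂ (descending-chain₂ m (suc m) m m<r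
        (ℕP.≤-reflexive (trans (before-adjacent 1 m) prog-1-m))
        (subst (suc r <_) three+r (ℕP.n≤1+n _)) ℕP.≤-refl)
      where
      open Zigzag decX decY (proj₁ (Equivalence.to hats I)) (proj₂ (Equivalence.to hats I))
      v≤u : defect r v ℤ.≤ defect r u
      v≤u = defect-≤ r v u
        (subst (λ p → at v p ℤ.≤ at u p) prog-1-m (odds m m<r))
        (subst (λ p → at u p ℤ.≤ at v p) prog-2-m (evens m m<r))

    from : Conditions false → Interlaced (at u) (at v) r
    from (D , ch₁ , ch₂) with chain₁-below r m (suc m) m (Equivalence.to C₁ ch₁)
                            | chain₂-below r m (suc m) m (Equivalence.to C₂ ch₂)
    ... | E₁ , _ , O₁ | O₂ , link , E₂ =
      Equivalence.from hats (Below-++ {g = Y} {f = X} {a = 1} O₂ O₁ , subst (Below X Y 2) count even-all)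
      where
      -- the even index r + 1, not covered by the pairs of the chains
      middle : Below X Y (prog 2 m) 1
      middle zero _ = subst (λ p → X p ℤ.≤ Y p) (sym prog-2-m)
        (subst (X (suc r) ℤ.≤_) (trans (cong Y (trans (before-adjacent 1 m) prog-1-m)) (flat v̂ D)) link)
      middle (suc j) (s≤s ())
      even-all : Below X Y 2 (m + 1 + m)
      even-all = Below-++ {g = X} {f = Y} {a = 2} (Below-++ {g = X} {f = Y} {a = 2} E₁ middle)
        (subst (λ a → Below X Y (prog 2 a) m) (ℕP.+-comm 1 m) E₂)
      count : m + 1 + m ≡ r
      count = arith m
        where
        arith : ∀ m → m + 1 + m ≡ suc (m + m)
        arith = ℕSolver.solve-∀

  splitting⇔ : Interlaced (at u) (at v) r ⇔ Conditions (even r)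
  splitting⇔ with r-parity r 1≤r
  ... | inj₁ (n , r≡) = subst (λ b → Interlaced (at u) (at v) r ⇔ Conditions b)
                              (sym (trans (cong even r≡) (even-double (suc n)))) (even-case n r≡)
  ... | inj₂ (m , r≡) = subst (λ b → Interlaced (at u) (at v) r ⇔ Conditions b)
                              (sym (trans (cong even r≡) (even-odd m))) (odd-case m r≡)

corollary4p2 : (r : ℕ) → 1 ℕ.≤ r → (u v : Vec ℤ (2 ℕ.* r)) → X0+ r u → X0+ r v →
    let d = defect r u ⊓ defect r v
        û = addℓ r d u
        v̂ = addℓ r d v
    in (∀ ρ → 1 ℕ.≤ ρ → ρ ℕ.≤ r →
          (at v (2 ℕ.* ρ ∸ 1) ℤ.≤ at u (2 ℕ.* ρ ∸ 1))
          × (at v (2 ℕ.* ρ) ℤ.≤ at v (2 ℕ.* ρ ∸ 1))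
          × (at u (2 ℕ.* ρ) ℤ.≤ at v (2 ℕ.* ρ)))
       ⇔ ((if even r then defect r û ≡ ℤ.0ℤ else defect r v̂ ≡ ℤ.0ℤ)
          × (θ₁' r v̂ ≺ θ₁ r û)
          × (θ₂' r v̂ ≺ θ₂ r û))
corollary4p2 r 1≤r u v Xu Xv = splitting⇔ ⇔-∘ interlacing⇔Interlaced r u v (proj₁ Xv)
  where open Splitting r 1≤r u v (proj₁ Xu) (proj₁ Xv)
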